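{- Let $\delta$ be a primitive element of $\mathbb{F}_9$ and let $\alpha\in\mathbb{F}_{81}$ satisfy $\alpha^2=\delta$, chosen such that $\{x\in\mathbb{F}_9 : x+\alpha \text{ is a nonzero square in } \mathbb{F}_{81}\}=\{\delta,\delta^2,\delta^5,\delta^6\}$. Let $H=\{1,\delta\}$ and $C_9=\{0\}\cup H\cup(\alpha+\delta^5)H\subseteq\mathbb{F}_{81}$. Then the setwise stabilizer of $C_9$ in $\mathrm{Aut}(P(9^2))$ is $\langle\phi'\rangle\cong\mathbb{Z}_2$, where $\phi'(\gamma)=(\alpha+\delta^5)\gamma^{9}$ for all $\gamma\in\mathbb{F}_{81}$. Moreover, the orbit of $C_9$ under $\mathrm{Aut}(P(9^2))$ (acting on subsets of $\mathbb{F}_{81}$) has size $6480$.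
   Context: For a prime power $q$, the Paley graph $P(q^2)$ has vertex set $\mathbb{F}_{q^2}$, two distinct vertices being adjacent iff their difference is a nonzero square in $\mathbb{F}_{q^2}$. Its automorphism group is $\mathrm{Aut}(P(q^2))=\{\gamma\mapsto a\gamma^{v}+b : a\in S,\ b\in\mathbb{F}_{q^2},\ v\in\mathrm{Gal}(\mathbb{F}_{q^2})\}$, where $S$ is the set of nonzero squares of $\mathbb{F}_{q^2}$ and $\gamma^v$ denotes the image of $\gamma$ under the field automorphism $v$. It acts on subsets of $\mathbb{F}_{q^2}$ elementwise. -}

module Defs where

open import Data.Nat using (ℕ; zero; suc)
open import Data.Fin using (Fin)
open import Data.Product using (Σ; _×_; _,_)
open import Data.Sum using (_⊎_)
open import Relation.Binary.PropositionalEquality using (_≡_; _≢_)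
open import Relation.Nullary using (¬_)

data F3 : Set where
  z3 o3 t3 : F3

_+₃_ : F3 → F3 → F3
z3 +₃ y = y
o3 +₃ z3 = o3
o3 +₃ o3 = t3
o3 +₃ t3 = z3
t3 +₃ z3 = t3
t3 +₃ o3 = z3
t3 +₃ t3 = o3

-₃_ : F3 → F3
-₃ z3 = z3
-₃ o3 = t3
-₃ t3 = o3

_*₃_ : F3 → F3 → F3
z3 *₃ y = z3
o3 *₃ y = y
t3 *₃ y = -₃ y

-- 𝔽₉ = 𝔽₃[i]/(i² + 1); mk9 a b represents a + b i
record F9 : Set where
  constructor mk9
  field
    re im : F3

0₉ 1₉ : F9
0₉ = mk9 z3 z3
1₉ = mk9 o3 z3

_+₉_ : F9 → F9 → F9
mk9 a b +₉ mk9 c d = mk9 (a +₃ c) (b +₃ d)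

_*₉_ : F9 → F9 → F9
mk9 a b *₉ mk9 c d = mk9 ((a *₃ c) +₃ (-₃ (b *₃ d))) ((a *₃ d) +₃ (b *₃ c))

_^₉_ : F9 → ℕ → F9
x ^₉ zero = 1₉
x ^₉ suc n = x *₉ (x ^₉ n)

-- ν = 1 + i, a non-square in 𝔽₉
ν : F9
ν = mk9 o3 o3

-- 𝔽₈₁ = 𝔽₉[y]/(y² − ν); mk81 u v represents u + v y
record F81 : Set where
  constructor mk81
  field
    lo hi : F9

0F 1F : F81
0F = mk81 0₉ 0₉
1F = mk81 1₉ 0₉

_+F_ : F81 → F81 → F81
mk81 a b +F mk81 c d = mk81 (a +₉ c) (b +₉ d)

_*F_ : F81 → F81 → F81
mk81 a b *F mk81 c d =
  mk81 ((a *₉ c) +₉ (ν *₉ (b *₉ d))) ((a *₉ d) +₉ (b *₉ c))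

infixl 6 _+F_
infixl 7 _*F_

_^F_ : F81 → ℕ → F81
x ^F zero = 1F
x ^F suc n = x *F (x ^F n)

ι : F9 → F81
ι x = mk81 x 0₉

Iff : ∀ {a b} → Set a → Set b → Set _
Iff A B = (A → B) × (B → A)

IsPrimitive9 : F9 → Set
IsPrimitive9 δ = ∀ x → x ≢ 0₉ → Σ ℕ λ k → δ ^₉ k ≡ x

IsNonzeroSquare : F81 → Set
IsNonzeroSquare a = (a ≢ 0F) × Σ F81 λ c → c *F c ≡ a

IsFieldAut : (F81 → F81) → Set
IsFieldAut σ =
  (∀ x y → σ (x +F y) ≡ σ x +F σ y) ×
  (∀ x y → σ (x *F y) ≡ σ x *F σ y) ×
  (σ 1F ≡ 1F) ×
  (∀ x y → σ x ≡ σ y → x ≡ y) ×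
  (∀ y → Σ F81 λ x → σ x ≡ y)

-- elements of Aut(P(81)): γ ↦ a γ^σ + b with a ∈ S, b ∈ 𝔽₈₁, σ ∈ Gal
record AutP : Set where
  field
    a : F81
    aS : IsNonzeroSquare a
    b : F81
    σ : F81 → F81
    σGal : IsFieldAut σ

applyAut : AutP → F81 → F81
applyAut g γ = AutP.a g *F AutP.σ g γ +F AutP.b g

Subset81 : Set₁
Subset81 = F81 → Set

_≐_ : Subset81 → Subset81 → Set
A ≐ B = ∀ y → Iff (A y) (B y)

image : (F81 → F81) → Subset81 → Subset81
image f A y = Σ F81 λ x → A x × f x ≡ y

InOrbit : Subset81 → Subset81 → Set
InOrbit C T = Σ AutP λ g → T ≐ image (applyAut g) C

OrbitHasSize : Subset81 → ℕ → Set₁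
OrbitHasSize C n =
  Σ (Fin n → Subset81) λ e →
    (∀ i → InOrbit C (e i)) ×
    (∀ T → InOrbit C T → Σ (Fin n) λ i → T ≐ e i) ×
    (∀ i j → e i ≐ e j → i ≡ j)

C9 : F9 → F81 → Subset81
C9 δ α y =
  (y ≡ 0F) ⊎ (y ≡ 1F) ⊎ (y ≡ ι δ) ⊎
  (y ≡ (α +F ι (δ ^₉ 5))) ⊎ (y ≡ (α +F ι (δ ^₉ 5)) *F ι δ)

φ′ : F9 → F81 → F81 → F81
φ′ δ α γ = (α +F ι (δ ^₉ 5)) *F (γ ^F 9)

{-# OPTIONS --safe #-}
-- Everything happens in fields with at most 81 elements, so facts about concrete elements are
-- decided by evaluation; the proof reduces the theorem to finitely many such facts.
-- An automorphism σ of 𝔽₈₁ is determined by σ𝕚 and σ𝕪, which satisfy (σ𝕚)² = −1 and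
-- (σ𝕪)² = 1 + σ𝕚; the only solutions are (frob^k 𝕚, frob^k 𝕪) with k < 4 and frob x = x³, so
-- every element of Aut(P(81)) acts as a semi-affine map a·frob^k + b with a ≠ 0. If it
-- stabilises C₉ then b, the image of 0, lies in C₉, and a search over b ∈ C₉, a ≠ 0, k < 4
-- leaves only the identity and φ′ = c·frob², where c = α + δ⁵ satisfies c·c⁹ = 1.
-- For the orbit, precomposing with φ′ turns the Galois part frob^(2+j) into frob^j, so every
-- image of C₉ is already its image under one of the 40·81·2 maps s²·frob^j + b (j < 2).
-- These images are distinct: if g and g′ give the same one then g′⁻¹ ∘ g stabilises C₉, so
-- g = g′ or g = g′ ∘ φ′, and the latter is impossible as the Galois parts would differ by frob².
-- Finally, the hypotheses on δ and α leave exactly four concrete pairs (δ, α).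
module Submission where

open import Defs
open import Data.Nat using (ℕ)
open import Data.Product using (Σ; _×_; _,_)
open import Data.Sum using (_⊎_)
open import Relation.Binary.PropositionalEquality using (_≡_)
open import Relation.Nullary using (¬_)

open import Algebra.Bundles using (CommutativeRing)
open import Data.Empty using (⊥-elim)
open import Data.Fin using (Fin; zero; suc; toℕ)
import Data.Fin.Properties as Fin
open import Data.Fin.Properties using (*↔×)
open import Data.List using (List; []; _∷_; cartesianProductWith)
open import Data.List.Membership.Propositional using (_∈_; lose)
open import Data.List.Membership.Propositional.Properties using (∈-cartesianProductWith⁺)
open import Data.List.Relation.Unary.All using (All)
import Data.List.Relation.Unary.All as All
open import Data.List.Relation.Unary.Any using (here; there)
import Data.List.Relation.Unary.Any as Any
import Data.Nat as ℕ
open import Data.Nat using (zero; suc; s≤s)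
open import Data.Nat.DivMod using (_%_; _/_; m≡m%n+[m/n]*n; m%n<n)
open import Data.Nat.Properties using (anyUpTo?; allUpTo?; *-suc; +-comm)
open import Data.Product using (∃; proj₁; proj₂; uncurry)
import Data.Product as Product
open import Data.Product.Function.NonDependent.Propositional using (_×-↔_)
open import Data.Product.Properties using (≡-dec)
open import Data.Sum using (inj₁; inj₂; [_,_]′)
import Data.Sum as Sum
open import Function using (id; _∘_)
open import Function.Bundles using (_↔_; Inverse; mk↔ₛ′)
open import Function.Properties.Inverse using (↔-refl; ↔-trans)
open import Relation.Binary.Definitions using (DecidableEquality)
open import Relation.Binary.PropositionalEquality
  using (_≢_; _≗_; refl; sym; trans; cong; cong₂; subst; isEquivalence; module ≡-Reasoning)
open import Relation.Nullary.Decidable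
  using (Dec; yes; no; map′; ¬?; _×-dec_; _⊎-dec_; _→-dec_; from-yes; dec⇒maybe)
open import Relation.Unary using (Pred; Decidable)
open import Tactic.RingSolver using (solve-∀)
open import Tactic.RingSolver.Core.AlmostCommutativeRing using (AlmostCommutativeRing; fromCommutativeRing)

infix 4 _≟₃_ _≟₉_ _≟_

_≟₃_ : DecidableEquality F3
z3 ≟₃ z3 = yes refl
o3 ≟₃ o3 = yes refl
t3 ≟₃ t3 = yes refl
z3 ≟₃ o3 = no λ ()
z3 ≟₃ t3 = no λ ()
o3 ≟₃ z3 = no λ ()
o3 ≟₃ t3 = no λ ()
t3 ≟₃ z3 = no λ ()
t3 ≟₃ o3 = no λ ()

_≟₉_ : DecidableEquality F9
mk9 a b ≟₉ mk9 c d =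
  map′ (λ (a≡c , b≡d) → cong₂ mk9 a≡c b≡d) (λ { refl → refl , refl }) (a ≟₃ c ×-dec b ≟₃ d)

_≟_ : DecidableEquality F81
mk81 a b ≟ mk81 c d =
  map′ (λ (a≡c , b≡d) → cong₂ mk81 a≡c b≡d) (λ { refl → refl , refl }) (a ≟₉ c ×-dec b ≟₉ d)

open import Data.List.Membership.DecPropositional _≟_ using (_∈?_)
open import Data.List.Membership.DecPropositional (≡-dec _≟₉_ _≟_) using () renaming (_∈?_ to _∈ₚ?_)

F3-elements : List F3
F3-elements = z3 ∷ o3 ∷ t3 ∷ []

F3-complete : ∀ x → x ∈ F3-elements
F3-complete z3 = here refl
F3-complete o3 = there (here refl)
F3-complete t3 = there (there (here refl))

F9-elements : List F9
F9-elements = cartesianProductWith mk9 F3-elements F3-elements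

F9-complete : ∀ x → x ∈ F9-elements
F9-complete (mk9 a b) = ∈-cartesianProductWith⁺ mk9 (F3-complete a) (F3-complete b)

F81-elements : List F81
F81-elements = cartesianProductWith mk81 F9-elements F9-elements

F81-complete : ∀ x → x ∈ F81-elements
F81-complete (mk81 u v) = ∈-cartesianProductWith⁺ mk81 (F9-complete u) (F9-complete v)

module Exhaustive {A : Set} {xs : List A} (complete : ∀ x → x ∈ xs) where

  all? : ∀ {p} {P : Pred A p} → Decidable P → Dec (∀ x → P x)
  all? P? = map′ (λ ps x → All.lookup ps (complete x)) (λ ps → All.tabulate (λ {x} _ → ps x)) (All.all? P? xs)

  any? : ∀ {p} {P : Pred A p} → Decidable P → Dec (∃ P)
  any? P? = map′ Any.satisfied (λ (x , px) → lose (complete x) px) (Any.any? P? xs)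

open Exhaustive F9-complete using () renaming (all? to all₉?)
open Exhaustive F81-complete using (all?; any?)

-₉_ : F9 → F9
-₉ mk9 a b = mk9 (-₃ a) (-₃ b)

F9-commutativeRing : CommutativeRing _ _
F9-commutativeRing = record
  { Carrier = F9 ; _≈_ = _≡_ ; _+_ = _+₉_ ; _*_ = _*₉_ ; -_ = -₉_ ; 0# = 0₉ ; 1# = 1₉
  ; isCommutativeRing = record
    { isRing = record
      { +-isAbelianGroup = record
        { isGroup = record
          { isMonoid = record
            { isSemigroup = record
              { isMagma = record { isEquivalence = isEquivalence ; ∙-cong = cong₂ _+₉_ }
              ; assoc = from-yes (all₉? λ x → all₉? λ y → all₉? λ z → (x +₉ y) +₉ z ≟₉ x +₉ (y +₉ z)) }
            ; identity = from-yes (all₉? λ x → 0₉ +₉ x ≟₉ x) , from-yes (all₉? λ x → x +₉ 0₉ ≟₉ x) }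
          ; inverse = from-yes (all₉? λ x → (-₉ x) +₉ x ≟₉ 0₉) , from-yes (all₉? λ x → x +₉ (-₉ x) ≟₉ 0₉)
          ; ⁻¹-cong = cong -₉_ }
        ; comm = from-yes (all₉? λ x → all₉? λ y → x +₉ y ≟₉ y +₉ x) }
      ; *-cong = cong₂ _*₉_
      ; *-assoc = from-yes (all₉? λ x → all₉? λ y → all₉? λ z → (x *₉ y) *₉ z ≟₉ x *₉ (y *₉ z))
      ; *-identity = from-yes (all₉? λ x → 1₉ *₉ x ≟₉ x) , from-yes (all₉? λ x → x *₉ 1₉ ≟₉ x)
      ; distrib = from-yes (all₉? λ x → all₉? λ y → all₉? λ z → x *₉ (y +₉ z) ≟₉ (x *₉ y) +₉ (x *₉ z))
                , from-yes (all₉? λ x → all₉? λ y → all₉? λ z → (y +₉ z) *₉ x ≟₉ (y *₉ x) +₉ (z *₉ x)) }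
    ; *-comm = from-yes (all₉? λ x → all₉? λ y → x *₉ y ≟₉ y *₉ x) } }

module 𝔽₉ = CommutativeRing F9-commutativeRing

F9-ring : AlmostCommutativeRing _ _
F9-ring = fromCommutativeRing F9-commutativeRing (λ x → dec⇒maybe (0₉ ≟₉ x))

*F-assoc-lo : ∀ n a b c d e f →
  (((a *₉ c) +₉ (n *₉ (b *₉ d))) *₉ e) +₉ (n *₉ (((a *₉ d) +₉ (b *₉ c)) *₉ f))
  ≡ (a *₉ ((c *₉ e) +₉ (n *₉ (d *₉ f)))) +₉ (n *₉ (b *₉ ((c *₉ f) +₉ (d *₉ e))))
*F-assoc-lo = solve-∀ F9-ring

*F-assoc-hi : ∀ n a b c d e f →
  (((a *₉ c) +₉ (n *₉ (b *₉ d))) *₉ f) +₉ (((a *₉ d) +₉ (b *₉ c)) *₉ e)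
  ≡ (a *₉ ((c *₉ f) +₉ (d *₉ e))) +₉ (b *₉ ((c *₉ e) +₉ (n *₉ (d *₉ f))))
*F-assoc-hi = solve-∀ F9-ring

*F-distribˡ-lo : ∀ n a b c d e f →
  (a *₉ (c +₉ e)) +₉ (n *₉ (b *₉ (d +₉ f)))
  ≡ ((a *₉ c) +₉ (n *₉ (b *₉ d))) +₉ ((a *₉ e) +₉ (n *₉ (b *₉ f)))
*F-distribˡ-lo = solve-∀ F9-ring

*F-distribˡ-hi : ∀ a b c d e f →
  (a *₉ (d +₉ f)) +₉ (b *₉ (c +₉ e)) ≡ ((a *₉ d) +₉ (b *₉ c)) +₉ ((a *₉ f) +₉ (b *₉ e))
*F-distribˡ-hi = solve-∀ F9-ring

-F_ : F81 → F81
-F mk81 a b = mk81 (-₉ a) (-₉ b)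

+F-assoc : ∀ x y z → (x +F y) +F z ≡ x +F (y +F z)
+F-assoc (mk81 a b) (mk81 c d) (mk81 e f) = cong₂ mk81 (𝔽₉.+-assoc a c e) (𝔽₉.+-assoc b d f)

+F-comm : ∀ x y → x +F y ≡ y +F x
+F-comm (mk81 a b) (mk81 c d) = cong₂ mk81 (𝔽₉.+-comm a c) (𝔽₉.+-comm b d)

*F-assoc : ∀ x y z → (x *F y) *F z ≡ x *F (y *F z)
*F-assoc (mk81 a b) (mk81 c d) (mk81 e f) =
  cong₂ mk81 (*F-assoc-lo ν a b c d e f) (*F-assoc-hi ν a b c d e f)

*F-comm : ∀ x y → x *F y ≡ y *F x
*F-comm = from-yes (all? λ x → all? λ y → x *F y ≟ y *F x)

*F-distribˡ : ∀ x y z → x *F (y +F z) ≡ (x *F y) +F (x *F z)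
*F-distribˡ (mk81 a b) (mk81 c d) (mk81 e f) =
  cong₂ mk81 (*F-distribˡ-lo ν a b c d e f) (*F-distribˡ-hi a b c d e f)

*F-distribʳ : ∀ x y z → (y +F z) *F x ≡ (y *F x) +F (z *F x)
*F-distribʳ x y z = begin
  (y +F z) *F x          ≡⟨ *F-comm (y +F z) x ⟩
  x *F (y +F z)          ≡⟨ *F-distribˡ x y z ⟩
  (x *F y) +F (x *F z)   ≡⟨ cong₂ _+F_ (*F-comm x y) (*F-comm x z) ⟩
  (y *F x) +F (z *F x)   ∎
  where open ≡-Reasoning

F81-commutativeRing : CommutativeRing _ _
F81-commutativeRing = record
  { Carrier = F81 ; _≈_ = _≡_ ; _+_ = _+F_ ; _*_ = _*F_ ; -_ = -F_ ; 0# = 0F ; 1# = 1F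
  ; isCommutativeRing = record
    { isRing = record
      { +-isAbelianGroup = record
        { isGroup = record
          { isMonoid = record
            { isSemigroup = record
              { isMagma = record { isEquivalence = isEquivalence ; ∙-cong = cong₂ _+F_ }
              ; assoc = +F-assoc }
            ; identity = from-yes (all? λ x → 0F +F x ≟ x) , from-yes (all? λ x → x +F 0F ≟ x) }
          ; inverse = from-yes (all? λ x → (-F x) +F x ≟ 0F) , from-yes (all? λ x → x +F (-F x) ≟ 0F)
          ; ⁻¹-cong = cong -F_ }
        ; comm = +F-comm }
      ; *-cong = cong₂ _*F_
      ; *-assoc = *F-assoc
      ; *-identity = from-yes (all? λ x → 1F *F x ≟ x) , from-yes (all? λ x → x *F 1F ≟ x)
      ; distrib = *F-distribˡ , *F-distribʳ }
    ; *-comm = *F-comm } }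

F81-ring : AlmostCommutativeRing _ _
F81-ring = fromCommutativeRing F81-commutativeRing (λ x → dec⇒maybe (0F ≟ x))

open CommutativeRing F81-commutativeRing
  using (+-group; *-identityˡ; *-identityʳ; +-identityˡ; +-identityʳ; zeroʳ)
open import Algebra.Properties.Group +-group using (identityˡ-unique; ∙-cancelʳ)

-- x⁸⁰ = 1 for x ≠ 0, so x⁷⁹ is the inverse (and 0 ⁻¹ = 0). Opaque, so that the symbolic power
-- x⁷⁹ is never unfolded during type checking.
opaque
  _⁻¹ : F81 → F81
  x ⁻¹ = x ^F 79

opaque
  unfolding _⁻¹

  *-inverseʳ : ∀ {x} → x ≢ 0F → x *F x ⁻¹ ≡ 1F
  *-inverseʳ {x} = from-yes (all? λ x → ¬? (x ≟ 0F) →-dec (x *F x ⁻¹ ≟ 1F)) x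

no-zero-divisors : ∀ {x y} → x *F y ≡ 0F → x ≡ 0F ⊎ y ≡ 0F
no-zero-divisors {x} {y} = from-yes (all? λ x → all? λ y → (x *F y ≟ 0F) →-dec (x ≟ 0F ⊎-dec y ≟ 0F)) x y

*-nonzero : ∀ {x y} → x ≢ 0F → y ≢ 0F → x *F y ≢ 0F
*-nonzero x≢0 y≢0 xy≡0 = [ x≢0 , y≢0 ]′ (no-zero-divisors xy≡0)

⁻¹-nonzero : ∀ {x} → x ≢ 0F → x ⁻¹ ≢ 0F
⁻¹-nonzero {x} x≢0 x⁻¹≡0 = 1≢0 (begin
  1F           ≡⟨ sym (*-inverseʳ x≢0) ⟩
  x *F x ⁻¹    ≡⟨ cong (x *F_) x⁻¹≡0 ⟩
  x *F 0F      ≡⟨ zeroʳ x ⟩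
  0F           ∎)
  where
  open ≡-Reasoning
  1≢0 : 1F ≢ 0F
  1≢0 ()

*-cancelˡ : ∀ {a x y} → a ≢ 0F → a *F x ≡ a *F y → x ≡ y
*-cancelˡ {a} {x} {y} a≢0 ax≡ay = begin
  x                     ≡⟨ sym (*-identityˡ x) ⟩
  1F *F x               ≡⟨ cong (_*F x) (sym (*-inverseʳ a≢0)) ⟩
  (a *F a ⁻¹) *F x      ≡⟨ cong (_*F x) (*F-comm a (a ⁻¹)) ⟩
  (a ⁻¹ *F a) *F x      ≡⟨ *F-assoc (a ⁻¹) a x ⟩
  a ⁻¹ *F (a *F x)      ≡⟨ cong (a ⁻¹ *F_) ax≡ay ⟩
  a ⁻¹ *F (a *F y)      ≡⟨ sym (*F-assoc (a ⁻¹) a y) ⟩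
  (a ⁻¹ *F a) *F y      ≡⟨ cong (_*F y) (*F-comm (a ⁻¹) a) ⟩
  (a *F a ⁻¹) *F y      ≡⟨ cong (_*F y) (*-inverseʳ a≢0) ⟩
  1F *F y               ≡⟨ *-identityˡ y ⟩
  y                     ∎
  where open ≡-Reasoning

isNonzeroSquare? : Decidable IsNonzeroSquare
isNonzeroSquare? x = ¬? (x ≟ 0F) ×-dec any? (λ s → s *F s ≟ x)

square-identity : ∀ s t → (s *F t) *F (s *F t) ≡ (s *F s) *F (t *F t)
square-identity = solve-∀ F81-ring

*-square : ∀ {x y} → IsNonzeroSquare x → IsNonzeroSquare y → IsNonzeroSquare (x *F y)
*-square (x≢0 , s , s²≡x) (y≢0 , t , t²≡y) =
  *-nonzero x≢0 y≢0 , s *F t , trans (square-identity s t) (cong₂ _*F_ s²≡x t²≡y)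

-- The Galois group of 𝔽₈₁

-- Opaque for the same reason: frob (frob x) must not unfold into a huge polynomial in the
-- coordinates of x. Its values are computed inside `unfolding frob` blocks only.
opaque
  frob : F81 → F81
  frob x = x ^F 3

frob^ : ℕ → F81 → F81
frob^ zero    x = x
frob^ (suc n) x = frob (frob^ n x)

frob^-+ : ∀ m n x → frob^ (m ℕ.+ n) x ≡ frob^ m (frob^ n x)
frob^-+ zero    n x = refl
frob^-+ (suc m) n x = cong frob (frob^-+ m n x)

opaque
  unfolding frob

  frob^4 : frob^ 4 ≗ id
  frob^4 = from-yes (all? λ x → frob^ 4 x ≟ x)

  ^9≗frob^2 : (λ x → x ^F 9) ≗ frob^ 2
  ^9≗frob^2 = from-yes (all? λ x → x ^F 9 ≟ frob^ 2 x)

  frob-+ : ∀ x y → frob (x +F y) ≡ frob x +F frob y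
  frob-+ = from-yes (all? λ x → all? λ y → frob (x +F y) ≟ frob x +F frob y)

  frob-* : ∀ x y → frob (x *F y) ≡ frob x *F frob y
  frob-* = from-yes (all? λ x → all? λ y → frob (x *F y) ≟ frob x *F frob y)

  frob-1 : frob 1F ≡ 1F
  frob-1 = refl

frob^-*4 : ∀ n → frob^ (n ℕ.* 4) ≗ id
frob^-*4 zero    x = refl
frob^-*4 (suc n) x = trans (frob^-+ 4 (n ℕ.* 4) x) (trans (frob^4 _) (frob^-*4 n x))

frob^-mod4 : ∀ k → frob^ k ≗ frob^ (k % 4)
frob^-mod4 k x = begin
  frob^ k x                                 ≡⟨ cong (λ n → frob^ n x) (m≡m%n+[m/n]*n k 4) ⟩
  frob^ (k % 4 ℕ.+ (k / 4) ℕ.* 4) x         ≡⟨ frob^-+ (k % 4) ((k / 4) ℕ.* 4) x ⟩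
  frob^ (k % 4) (frob^ ((k / 4) ℕ.* 4) x)   ≡⟨ cong (frob^ (k % 4)) (frob^-*4 (k / 4) x) ⟩
  frob^ (k % 4) x                           ∎
  where open ≡-Reasoning

frob^-mod4≡ : ∀ k {m} → k % 4 ≡ m → frob^ k ≗ frob^ m
frob^-mod4≡ k k%4≡m x = trans (frob^-mod4 k x) (cong (λ n → frob^ n x) k%4≡m)

IsFieldAut-≗ : ∀ {σ τ} → σ ≗ τ → IsFieldAut τ → IsFieldAut σ
IsFieldAut-≗ {σ} {τ} σ≗τ (+-hom , *-hom , 1-hom , inj , surj) =
  (λ x y → trans (σ≗τ (x +F y)) (trans (+-hom x y) (sym (cong₂ _+F_ (σ≗τ x) (σ≗τ y))))) ,
  (λ x y → trans (σ≗τ (x *F y)) (trans (*-hom x y) (sym (cong₂ _*F_ (σ≗τ x) (σ≗τ y))))) ,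
  trans (σ≗τ 1F) 1-hom ,
  (λ x y σx≡σy → inj x y (trans (sym (σ≗τ x)) (trans σx≡σy (σ≗τ y)))) ,
  (λ y → let (x , τx≡y) = surj y in x , trans (σ≗τ x) τx≡y)

IsFieldAut-id : IsFieldAut id
IsFieldAut-id = (λ _ _ → refl) , (λ _ _ → refl) , refl , (λ _ _ x≡y → x≡y) , (λ y → y , refl)

IsFieldAut-∘ : ∀ {σ τ} → IsFieldAut σ → IsFieldAut τ → IsFieldAut (σ ∘ τ)
IsFieldAut-∘ {σ} {τ} (σ-+ , σ-* , σ-1 , σ-inj , σ-surj) (τ-+ , τ-* , τ-1 , τ-inj , τ-surj) =
  (λ x y → trans (cong σ (τ-+ x y)) (σ-+ (τ x) (τ y))) ,
  (λ x y → trans (cong σ (τ-* x y)) (σ-* (τ x) (τ y))) ,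
  trans (cong σ τ-1) σ-1 ,
  (λ x y στx≡στy → τ-inj x y (σ-inj (τ x) (τ y) στx≡στy)) ,
  (λ z → let (y , σy≡z) = σ-surj z ; (x , τx≡y) = τ-surj y in x , trans (cong σ τx≡y) σy≡z)

frob-isFieldAut : IsFieldAut frob
frob-isFieldAut = frob-+ , frob-* , frob-1 , injective , (λ y → frob^ 3 y , frob^4 y)
  where
  open ≡-Reasoning
  injective : ∀ x y → frob x ≡ frob y → x ≡ y
  injective x y frobx≡froby = begin
    x                 ≡⟨ sym (frob^4 x) ⟩
    frob^ 4 x         ≡⟨ frob^-+ 3 1 x ⟩
    frob^ 3 (frob x)  ≡⟨ cong (frob^ 3) frobx≡froby ⟩
    frob^ 3 (frob y)  ≡⟨ sym (frob^-+ 3 1 y) ⟩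
    frob^ 4 y         ≡⟨ frob^4 y ⟩
    y                 ∎

frob^-isFieldAut : ∀ n → IsFieldAut (frob^ n)
frob^-isFieldAut zero    = IsFieldAut-id
frob^-isFieldAut (suc n) = IsFieldAut-∘ frob-isFieldAut (frob^-isFieldAut n)

𝕚 𝕪 : F81
𝕚 = ι (mk9 z3 o3)
𝕪 = mk81 0₉ 1₉

fromF3 : F3 → F81
fromF3 p = ι (mk9 p z3)

expand : F81 → F81 → F81 → F81
expand (mk81 (mk9 p q) (mk9 r s)) u v = (fromF3 p +F fromF3 q *F u) +F (fromF3 r +F fromF3 s *F u) *F v

expand-𝕚𝕪 : ∀ x → x ≡ expand x 𝕚 𝕪
expand-𝕚𝕪 = from-yes (all? λ x → x ≟ expand x 𝕚 𝕪)

module FieldAut {σ : F81 → F81} (σ-aut : IsFieldAut σ) where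

  σ-+ : ∀ x y → σ (x +F y) ≡ σ x +F σ y
  σ-+ = proj₁ σ-aut

  σ-* : ∀ x y → σ (x *F y) ≡ σ x *F σ y
  σ-* = proj₁ (proj₂ σ-aut)

  σ-1 : σ 1F ≡ 1F
  σ-1 = proj₁ (proj₂ (proj₂ σ-aut))

  σ-injective : ∀ x y → σ x ≡ σ y → x ≡ y
  σ-injective = proj₁ (proj₂ (proj₂ (proj₂ σ-aut)))

  σ-0 : σ 0F ≡ 0F
  σ-0 = identityˡ-unique (σ 0F) (σ 0F) (sym (σ-+ 0F 0F))

  σ-nonzero : ∀ {x} → x ≢ 0F → σ x ≢ 0F
  σ-nonzero {x} x≢0 σx≡0 = x≢0 (σ-injective x 0F (trans σx≡0 (sym σ-0)))

  σ-affine : ∀ a x b → σ (a *F x +F b) ≡ σ a *F σ x +F σ b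
  σ-affine a x b = trans (σ-+ (a *F x) b) (cong (_+F σ b) (σ-* a x))

  σ-fromF3 : ∀ p → σ (fromF3 p) ≡ fromF3 p
  σ-fromF3 z3 = σ-0
  σ-fromF3 o3 = σ-1
  σ-fromF3 t3 = trans (σ-+ 1F 1F) (cong₂ _+F_ σ-1 σ-1)

  σ-expand : ∀ x → σ x ≡ expand x (σ 𝕚) (σ 𝕪)
  σ-expand x@(mk81 (mk9 p q) (mk9 r s)) = begin
    σ x
      ≡⟨ cong σ (expand-𝕚𝕪 x) ⟩
    σ ((fromF3 p +F fromF3 q *F 𝕚) +F (fromF3 r +F fromF3 s *F 𝕚) *F 𝕪)
      ≡⟨ σ-+ _ _ ⟩
    σ (fromF3 p +F fromF3 q *F 𝕚) +F σ ((fromF3 r +F fromF3 s *F 𝕚) *F 𝕪)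
      ≡⟨ cong₂ _+F_ (σ-linear p q) (trans (σ-* _ 𝕪) (cong (_*F σ 𝕪) (σ-linear r s))) ⟩
    expand x (σ 𝕚) (σ 𝕪)
      ∎
    where
    open ≡-Reasoning
    σ-linear : ∀ p q → σ (fromF3 p +F fromF3 q *F 𝕚) ≡ fromF3 p +F fromF3 q *F σ 𝕚
    σ-linear p q = trans (σ-+ _ _) (cong₂ _+F_ (σ-fromF3 p) (trans (σ-* _ 𝕚) (cong (_*F σ 𝕚) (σ-fromF3 q))))

  σ𝕚-root : σ 𝕚 *F σ 𝕚 ≡ fromF3 t3
  σ𝕚-root = trans (sym (σ-* 𝕚 𝕚)) (σ-fromF3 t3)

  σ𝕪-root : σ 𝕪 *F σ 𝕪 ≡ 1F +F σ 𝕚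
  σ𝕪-root = trans (sym (σ-* 𝕪 𝕪)) (trans (σ-+ 1F 𝕚) (cong (_+F σ 𝕚) σ-1))

opaque
  unfolding frob

  generator-images : ∀ u v → u *F u ≡ fromF3 t3 → v *F v ≡ 1F +F u →
                     ∃ λ k → k ℕ.< 4 × u ≡ frob^ k 𝕚 × v ≡ frob^ k 𝕪
  generator-images = from-yes (all? λ u → all? λ v → (u *F u ≟ fromF3 t3) →-dec (v *F v ≟ 1F +F u) →-dec
                       anyUpTo? (λ k → u ≟ frob^ k 𝕚 ×-dec v ≟ frob^ k 𝕪) 4)

  twists-distinct : ∀ (j j′ : Fin 2) → frob^ (toℕ j) 𝕪 ≡ frob^ (toℕ j′) 𝕪 → j ≡ j′
  twists-distinct = from-yes (Fin.all? λ (j : Fin 2) → Fin.all? λ (j′ : Fin 2) →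
                      (frob^ (toℕ j) 𝕪 ≟ frob^ (toℕ j′) 𝕪) →-dec j Fin.≟ j′)

  twists-apart : ∀ (j j′ : Fin 2) → frob^ (toℕ j) 𝕪 ≢ frob^ (toℕ j′ ℕ.+ 2) 𝕪
  twists-apart = from-yes (Fin.all? λ (j : Fin 2) → Fin.all? λ (j′ : Fin 2) →
                   ¬? (frob^ (toℕ j) 𝕪 ≟ frob^ (toℕ j′ ℕ.+ 2) 𝕪))

fieldAut-classification : ∀ {σ} → IsFieldAut σ → ∃ λ k → k ℕ.< 4 × σ ≗ frob^ k
fieldAut-classification {σ} σ-aut =
  let (k , k<4 , σ𝕚≡ , σ𝕪≡) = generator-images (σ 𝕚) (σ 𝕪) σ𝕚-root σ𝕪-root
  in k , k<4 , λ x → begin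
    σ x                               ≡⟨ σ-expand x ⟩
    expand x (σ 𝕚) (σ 𝕪)              ≡⟨ cong₂ (expand x) σ𝕚≡ σ𝕪≡ ⟩
    expand x (frob^ k 𝕚) (frob^ k 𝕪)  ≡⟨ sym (FieldAut.σ-expand (frob^-isFieldAut k) x) ⟩
    frob^ k x                         ∎
  where
  open FieldAut σ-aut
  open ≡-Reasoning

frob^-0 : ∀ k → frob^ k 0F ≡ 0F
frob^-0 k = FieldAut.σ-0 (frob^-isFieldAut k)

frob^-nonzero : ∀ k {x} → x ≢ 0F → frob^ k x ≢ 0F
frob^-nonzero k = FieldAut.σ-nonzero (frob^-isFieldAut k)

frob^-affine : ∀ k a x b → frob^ k (a *F x +F b) ≡ frob^ k a *F frob^ k x +F frob^ k b
frob^-affine k = FieldAut.σ-affine (frob^-isFieldAut k)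

frob^-square : ∀ k {x} → IsNonzeroSquare x → IsNonzeroSquare (frob^ k x)
frob^-square k (x≢0 , s , s²≡x) = frob^-nonzero k x≢0 , frob^ k s , trans (sym (σ-* s s)) (cong (frob^ k) s²≡x)
  where open FieldAut (frob^-isFieldAut k)

-- Semi-affine maps

record SemiAffine : Set where
  constructor semiAffine
  field
    scale shift : F81
    twist       : ℕ

open SemiAffine

⟦_⟧ : SemiAffine → F81 → F81
⟦ semiAffine a b k ⟧ x = a *F frob^ k x +F b

infixr 9 _∘ₐ_
infix 10 _⁻¹ₐ

_∘ₐ_ : SemiAffine → SemiAffine → SemiAffine
semiAffine a b k ∘ₐ semiAffine a′ b′ k′ = semiAffine (a *F frob^ k a′) (a *F frob^ k b′ +F b) (k ℕ.+ k′)

_⁻¹ₐ : SemiAffine → SemiAffine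
semiAffine a b k ⁻¹ₐ = semiAffine (frob^ (k ℕ.* 3) (a ⁻¹)) (frob^ (k ℕ.* 3) (-F (a ⁻¹ *F b))) (k ℕ.* 3)

compose-identity : ∀ a A X B b → (a *F A) *F X +F (a *F B +F b) ≡ a *F (A *F X +F B) +F b
compose-identity = solve-∀ F81-ring

⟦∘ₐ⟧ : ∀ f g → ⟦ f ∘ₐ g ⟧ ≗ ⟦ f ⟧ ∘ ⟦ g ⟧
⟦∘ₐ⟧ (semiAffine a b k) (semiAffine a′ b′ k′) x = begin
  (a *F frob^ k a′) *F frob^ (k ℕ.+ k′) x +F (a *F frob^ k b′ +F b)
    ≡⟨ cong (λ z → (a *F frob^ k a′) *F z +F (a *F frob^ k b′ +F b)) (frob^-+ k k′ x) ⟩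
  (a *F frob^ k a′) *F frob^ k (frob^ k′ x) +F (a *F frob^ k b′ +F b)
    ≡⟨ compose-identity a (frob^ k a′) (frob^ k (frob^ k′ x)) (frob^ k b′) b ⟩
  a *F (frob^ k a′ *F frob^ k (frob^ k′ x) +F frob^ k b′) +F b
    ≡⟨ cong (λ z → a *F z +F b) (sym (frob^-affine k a′ (frob^ k′ x) b′)) ⟩
  a *F frob^ k (a′ *F frob^ k′ x +F b′) +F b
    ∎
  where open ≡-Reasoning

inverse-identityʳ : ∀ a a′ y b → a *F (a′ *F y +F -F (a′ *F b)) +F b ≡ (a *F a′) *F (y +F -F b) +F b
inverse-identityʳ = solve-∀ F81-ring

inverse-identityˡ : ∀ a a′ x b → a′ *F (a *F x +F b) +F -F (a′ *F b) ≡ (a′ *F a) *F x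
inverse-identityˡ = solve-∀ F81-ring

unit-identity : ∀ y b → 1F *F (y +F -F b) +F b ≡ y
unit-identity = solve-∀ F81-ring

⁻¹ₐ-inverseʳ : ∀ f → scale f ≢ 0F → ⟦ f ⟧ ∘ ⟦ f ⁻¹ₐ ⟧ ≗ id
⁻¹ₐ-inverseʳ (semiAffine a b k) a≢0 y = begin
  a *F frob^ k (frob^ k′ (a ⁻¹) *F frob^ k′ y +F frob^ k′ (-F (a ⁻¹ *F b))) +F b
    ≡⟨ cong (λ z → a *F z +F b) (frob^-affine k _ _ _) ⟩
  a *F (frob^ k (frob^ k′ (a ⁻¹)) *F frob^ k (frob^ k′ y) +F frob^ k (frob^ k′ (-F (a ⁻¹ *F b)))) +F b
    ≡⟨ cong (λ z → a *F z +F b) (cong₂ _+F_ (cong₂ _*F_ (cancel (a ⁻¹)) (cancel y)) (cancel _)) ⟩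
  a *F (a ⁻¹ *F y +F -F (a ⁻¹ *F b)) +F b
    ≡⟨ inverse-identityʳ a (a ⁻¹) y b ⟩
  (a *F a ⁻¹) *F (y +F -F b) +F b
    ≡⟨ cong (λ z → z *F (y +F -F b) +F b) (*-inverseʳ a≢0) ⟩
  1F *F (y +F -F b) +F b
    ≡⟨ unit-identity y b ⟩
  y ∎
  where
  open ≡-Reasoning
  k′ : ℕ
  k′ = k ℕ.* 3
  cancel : ∀ x → frob^ k (frob^ k′ x) ≡ x
  cancel x = trans (sym (frob^-+ k k′ x)) (trans (cong (λ n → frob^ n x) (sym (*-suc k 3))) (frob^-*4 k x))

⁻¹ₐ-inverseˡ : ∀ f → scale f ≢ 0F → ⟦ f ⁻¹ₐ ⟧ ∘ ⟦ f ⟧ ≗ id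
⁻¹ₐ-inverseˡ (semiAffine a b k) a≢0 x = begin
  frob^ k′ (a ⁻¹) *F frob^ k′ (a *F frob^ k x +F b) +F frob^ k′ (-F (a ⁻¹ *F b))
    ≡⟨ sym (cong (_+F frob^ k′ (-F (a ⁻¹ *F b))) (σ-* (a ⁻¹) _)) ⟩
  frob^ k′ (a ⁻¹ *F (a *F frob^ k x +F b)) +F frob^ k′ (-F (a ⁻¹ *F b))
    ≡⟨ sym (σ-+ _ _) ⟩
  frob^ k′ (a ⁻¹ *F (a *F frob^ k x +F b) +F -F (a ⁻¹ *F b))
    ≡⟨ cong (frob^ k′) (inverse-identityˡ a (a ⁻¹) (frob^ k x) b) ⟩
  frob^ k′ ((a ⁻¹ *F a) *F frob^ k x)
    ≡⟨ cong (λ z → frob^ k′ (z *F frob^ k x)) (trans (*F-comm (a ⁻¹) a) (*-inverseʳ a≢0)) ⟩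
  frob^ k′ (1F *F frob^ k x)
    ≡⟨ cong (frob^ k′) (*-identityˡ (frob^ k x)) ⟩
  frob^ k′ (frob^ k x)
    ≡⟨ sym (frob^-+ k′ k x) ⟩
  frob^ (k′ ℕ.+ k) x
    ≡⟨ cong (λ n → frob^ n x) (trans (+-comm k′ k) (sym (*-suc k 3))) ⟩
  frob^ (k ℕ.* 4) x
    ≡⟨ frob^-*4 k x ⟩
  x ∎
  where
  open ≡-Reasoning
  k′ : ℕ
  k′ = k ℕ.* 3
  open FieldAut (frob^-isFieldAut k′)

∘ₐ-nonzero : ∀ f g → scale f ≢ 0F → scale g ≢ 0F → scale (f ∘ₐ g) ≢ 0F
∘ₐ-nonzero (semiAffine a b k) (semiAffine a′ b′ k′) a≢0 a′≢0 = *-nonzero a≢0 (frob^-nonzero k a′≢0)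

⁻¹ₐ-nonzero : ∀ f → scale f ≢ 0F → scale (f ⁻¹ₐ) ≢ 0F
⁻¹ₐ-nonzero (semiAffine a b k) a≢0 = frob^-nonzero (k ℕ.* 3) (⁻¹-nonzero a≢0)

⟦⟧-at-0 : ∀ f → ⟦ f ⟧ 0F ≡ shift f
⟦⟧-at-0 (semiAffine a b k) = begin
  a *F frob^ k 0F +F b  ≡⟨ cong (λ z → a *F z +F b) (frob^-0 k) ⟩
  a *F 0F +F b          ≡⟨ cong (_+F b) (zeroʳ a) ⟩
  0F +F b               ≡⟨ +-identityˡ b ⟩
  b                     ∎
  where open ≡-Reasoning

⟦⟧-at-1 : ∀ f → ⟦ f ⟧ 1F ≡ scale f +F shift f
⟦⟧-at-1 (semiAffine a b k) =
  trans (cong (λ z → a *F z +F b) (FieldAut.σ-1 (frob^-isFieldAut k))) (cong (_+F b) (*-identityʳ a))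

⟦⟧-≗ : ∀ f g → scale f ≡ scale g → shift f ≡ shift g → frob^ (twist f) ≗ frob^ (twist g) → ⟦ f ⟧ ≗ ⟦ g ⟧
⟦⟧-≗ (semiAffine a b k) (semiAffine a′ b′ k′) a≡a′ b≡b′ frob^k≗frob^k′ x =
  trans (cong (λ z → a *F z +F b) (frob^k≗frob^k′ x)) (cong₂ (λ a″ b″ → a″ *F frob^ k′ x +F b″) a≡a′ b≡b′)

⟦⟧-injective-parameters : ∀ f g → scale f ≢ 0F → ⟦ f ⟧ ≗ ⟦ g ⟧ →
                          scale f ≡ scale g × shift f ≡ shift g × frob^ (twist f) ≗ frob^ (twist g)
⟦⟧-injective-parameters f@(semiAffine a b k) g@(semiAffine a′ b′ k′) a≢0 f≗g = a≡a′ , b≡b′ , frob^k≗frob^k′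
  where
  b≡b′ : b ≡ b′
  b≡b′ = trans (sym (⟦⟧-at-0 f)) (trans (f≗g 0F) (⟦⟧-at-0 g))
  a≡a′ : a ≡ a′
  a≡a′ = ∙-cancelʳ b a a′ (trans (sym (⟦⟧-at-1 f)) (trans (f≗g 1F) (trans (⟦⟧-at-1 g) (cong (a′ +F_) (sym b≡b′)))))
  frob^k≗frob^k′ : frob^ k ≗ frob^ k′
  frob^k≗frob^k′ x = *-cancelˡ a≢0 (∙-cancelʳ b _ _
    (trans (f≗g x) (cong₂ (λ a″ b″ → a″ *F frob^ k′ x +F b″) (sym a≡a′) (sym b≡b′))))

toAutP : (f : SemiAffine) → IsNonzeroSquare (scale f) → AutP
toAutP f f-square = record
  { a = scale f ; aS = f-square ; b = shift f ; σ = frob^ (twist f) ; σGal = frob^-isFieldAut (twist f) }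

applyAut-semiAffine : ∀ g → ∃ λ k → k ℕ.< 4 × applyAut g ≗ ⟦ semiAffine (AutP.a g) (AutP.b g) k ⟧
applyAut-semiAffine g =
  let (k , k<4 , σ≗frob^k) = fieldAut-classification σGal
  in k , k<4 , λ x → cong (λ z → a *F z +F b) (σ≗frob^k x)
  where open AutP g

≐-refl : ∀ {A} → A ≐ A
≐-refl y = id , id

≐-sym : ∀ {A B} → A ≐ B → B ≐ A
≐-sym A≐B y = proj₂ (A≐B y) , proj₁ (A≐B y)

≐-trans : ∀ {A B D} → A ≐ B → B ≐ D → A ≐ D
≐-trans A≐B B≐D y = proj₁ (B≐D y) ∘ proj₁ (A≐B y) , proj₂ (A≐B y) ∘ proj₂ (B≐D y)

image-≗ : ∀ {f g} A → f ≗ g → image f A ≐ image g A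
image-≗ A f≗g y = (λ (x , Ax , fx≡y) → x , Ax , trans (sym (f≗g x)) fx≡y)
                , (λ (x , Ax , gx≡y) → x , Ax , trans (f≗g x) gx≡y)

image-∘ : ∀ f g A → image (f ∘ g) A ≐ image f (image g A)
image-∘ f g A y = (λ (x , Ax , fgx≡y) → g x , (x , Ax , refl) , fgx≡y)
                , (λ { (_ , (x , Ax , refl) , fgx≡y) → x , Ax , fgx≡y })

image-resp : ∀ f {A B} → A ≐ B → image f A ≐ image f B
image-resp f A≐B y = (λ (x , Ax , fx≡y) → x , proj₁ (A≐B x) Ax , fx≡y)
                   , (λ (x , Bx , fx≡y) → x , proj₂ (A≐B x) Bx , fx≡y)

image-id : ∀ {f} A → f ≗ id → image f A ≐ A
image-id A f≗id y = (λ (x , Ax , fx≡y) → subst A (trans (sym (f≗id x)) fx≡y) Ax) , (λ Ay → y , Ay , f≗id y)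

image-involution : ∀ {f} A → (∀ x → A x → A (f x)) → f ∘ f ≗ id → image f A ≐ A
image-involution {f} A f-maps f-involutive y =
  (λ (x , Ax , fx≡y) → subst A fx≡y (f-maps x Ax)) , (λ Ay → f y , f-maps y Ay , f-involutive y)

orbitHasSize-by-representatives : ∀ {n} {R : Set} C → Fin n ↔ R → (rep : R → AutP) →
  (∀ g → ∃ λ t → image (applyAut g) C ≐ image (applyAut (rep t)) C) →
  (∀ t t′ → image (applyAut (rep t)) C ≐ image (applyAut (rep t′)) C → t ≡ t′) →
  OrbitHasSize C n
orbitHasSize-by-representatives C index rep cover distinct =
  orbit , (λ i → rep (to i) , ≐-refl) , covers , injective
  where
  open Inverse index
  orbit : Fin _ → Subset81
  orbit i = image (applyAut (rep (to i))) C
  covers : ∀ T → InOrbit C T → ∃ λ i → T ≐ orbit i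
  covers T (g , T≐g[C]) =
    let (t , g[C]≐t[C]) = cover g
    in from t , ≐-trans T≐g[C]
                  (subst (λ t′ → image (applyAut g) C ≐ image (applyAut (rep t′)) C) (sym (strictlyInverseˡ t)) g[C]≐t[C])
  injective : ∀ i j → orbit i ≐ orbit j → i ≡ j
  injective i j orbit-i≐orbit-j =
    trans (sym (strictlyInverseʳ i)) (trans (cong from (distinct (to i) (to j) orbit-i≐orbit-j)) (strictlyInverseʳ j))

-- ω generates 𝔽₈₁ˣ, so the squares of ω⁰, …, ω³⁹ are the 40 nonzero squares, each once.
ω : F81
ω = mk81 (mk9 z3 o3) (mk9 o3 z3)

root : Fin 40 → F81
root i = ω ^F toℕ i

-- Opaque: unfolding these proofs would rerun the searches during type checking.
opaque
  root-nonzero : ∀ i → root i ≢ 0F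
  root-nonzero = from-yes (Fin.all? λ i → ¬? (root i ≟ 0F))

  root²-injective : ∀ i j → root i *F root i ≡ root j *F root j → i ≡ j
  root²-injective = from-yes (Fin.all? λ i → Fin.all? λ j → (root i *F root i ≟ root j *F root j) →-dec i Fin.≟ j)

  root²-surjective : ∀ {a} → IsNonzeroSquare a → ∃ λ i → root i *F root i ≡ a
  root²-surjective {a} (a≢0 , s , s²≡a) =
    let (i , root²≡s²) = of-nonzero s (λ s≡0 → a≢0 (trans (sym s²≡a) (cong (λ z → z *F z) s≡0)))
    in i , trans root²≡s² s²≡a
    where
    of-nonzero : ∀ s → s ≢ 0F → ∃ λ i → root i *F root i ≡ s *F s
    of-nonzero = from-yes (all? λ s → ¬? (s ≟ 0F) →-dec Fin.any? λ i → root i *F root i ≟ s *F s)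

root²-nonzero : ∀ i → root i *F root i ≢ 0F
root²-nonzero i = *-nonzero (root-nonzero i) (root-nonzero i)

Representative : Set
Representative = Fin 40 × F81 × Fin 2

representative : Representative → SemiAffine
representative (i , b , j) = semiAffine (root i *F root i) b (toℕ j)

representativeAut : Representative → AutP
representativeAut t@(i , _ , _) = toAutP (representative t) (root²-nonzero i , root i , refl)

representative-of : ∀ {a} b j → IsNonzeroSquare a → ∃ λ t → ⟦ semiAffine a b (toℕ j) ⟧ ≗ ⟦ representative t ⟧
representative-of {a} b j a-square =
  let (i , root²≡a) = root²-surjective a-square
  in (i , b , j) , ⟦⟧-≗ (semiAffine a b (toℕ j)) (representative (i , b , j)) (sym root²≡a) refl (λ _ → refl)

Fin3↔F3 : Fin 3 ↔ F3
Fin3↔F3 = mk↔ₛ′ to from (λ { z3 → refl ; o3 → refl ; t3 → refl })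
                         (λ { zero → refl ; (suc zero) → refl ; (suc (suc zero)) → refl })
  where
  to : Fin 3 → F3
  to zero             = z3
  to (suc zero)       = o3
  to (suc (suc zero)) = t3
  from : F3 → Fin 3
  from z3 = zero
  from o3 = suc zero
  from t3 = suc (suc zero)

Fin9↔F9 : Fin 9 ↔ F9
Fin9↔F9 = ↔-trans *↔× (↔-trans (Fin3↔F3 ×-↔ Fin3↔F3)
            (mk↔ₛ′ (uncurry mk9) (λ x → F9.re x , F9.im x) (λ _ → refl) (λ _ → refl)))

Fin81↔F81 : Fin 81 ↔ F81
Fin81↔F81 = ↔-trans *↔× (↔-trans (Fin9↔F9 ×-↔ Fin9↔F9)
              (mk↔ₛ′ (uncurry mk81) (λ x → F81.lo x , F81.hi x) (λ _ → refl) (λ _ → refl)))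

Fin6480↔Representative : Fin 6480 ↔ Representative
Fin6480↔Representative = ↔-trans (*↔× {40} {162}) (↔-refl ×-↔ ↔-trans (*↔× {81} {2}) (Fin81↔F81 ×-↔ ↔-refl))

split-twist : ∀ {k} → k ℕ.< 4 → ∃ λ (j : Fin 2) → k ≡ toℕ j ⊎ k ≡ 2 ℕ.+ toℕ j
split-twist {0} _ = zero , inj₁ refl
split-twist {1} _ = suc zero , inj₁ refl
split-twist {2} _ = zero , inj₂ refl
split-twist {3} _ = suc zero , inj₂ refl
split-twist {suc (suc (suc (suc _)))} (s≤s (s≤s (s≤s (s≤s ()))))

twist+2-mod4 : ∀ (j : Fin 2) → (2 ℕ.+ toℕ j ℕ.+ 2) % 4 ≡ toℕ j
twist+2-mod4 zero       = refl
twist+2-mod4 (suc zero) = refl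

module Configuration (δ : F9) (α : F81) where

  c : F81
  c = α +F ι (δ ^₉ 5)

  C : Subset81
  C = C9 δ α

  φ : F81 → F81
  φ = φ′ δ α

  φₐ : SemiAffine
  φₐ = semiAffine c 0F 2

  C-elements : List F81
  C-elements = 0F ∷ 1F ∷ ι δ ∷ c ∷ c *F ι δ ∷ []

  ∈⇒C : ∀ {y} → y ∈ C-elements → C y
  ∈⇒C (here y≡0)                                  = inj₁ y≡0
  ∈⇒C (there (here y≡1))                          = inj₂ (inj₁ y≡1)
  ∈⇒C (there (there (here y≡δ)))                  = inj₂ (inj₂ (inj₁ y≡δ))
  ∈⇒C (there (there (there (here y≡c))))          = inj₂ (inj₂ (inj₂ (inj₁ y≡c)))
  ∈⇒C (there (there (there (there (here y≡cδ))))) = inj₂ (inj₂ (inj₂ (inj₂ y≡cδ)))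

  C⇒∈ : ∀ {y} → C y → y ∈ C-elements
  C⇒∈ (inj₁ y≡0)                       = here y≡0
  C⇒∈ (inj₂ (inj₁ y≡1))                = there (here y≡1)
  C⇒∈ (inj₂ (inj₂ (inj₁ y≡δ)))         = there (there (here y≡δ))
  C⇒∈ (inj₂ (inj₂ (inj₂ (inj₁ y≡c))))  = there (there (there (here y≡c)))
  C⇒∈ (inj₂ (inj₂ (inj₂ (inj₂ y≡cδ)))) = there (there (there (there (here y≡cδ))))

  MapsC : (F81 → F81) → Set
  MapsC f = All (λ x → f x ∈ C-elements) C-elements

  MapsC⇒ : ∀ {f} → MapsC f → ∀ x → C x → C (f x)
  MapsC⇒ f-maps x Cx = ∈⇒C (All.lookup f-maps (C⇒∈ Cx))

  ⇒MapsC : ∀ {f} → (∀ x → C x → C (f x)) → MapsC f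
  ⇒MapsC f-maps = All.tabulate (λ x∈ → C⇒∈ (f-maps _ (∈⇒C x∈)))

  -- A map stabilising C sends 0 to its shift, so only shifts in C need to be searched. The
  -- fields mention ⟦ φₐ ⟧ rather than φ: the latter unfolds into a symbolic ninth power.
  record Certificate : Set where
    field
      c-square              : IsNonzeroSquare c
      c-norm                : c *F frob^ 2 c ≡ 1F
      c≢1                   : c ≢ 1F
      φ-maps-C              : MapsC ⟦ φₐ ⟧
      stabilizer-parameters : All (λ b → ∀ a → a ≢ 0F → ∀ {k} → k ℕ.< 4 → MapsC ⟦ semiAffine a b k ⟧ →
                                        (a ≡ 1F × b ≡ 0F × k ≡ 0) ⊎ (a ≡ c × b ≡ 0F × k ≡ 2))
                                  C-elements

  certificate? : Dec Certificate
  certificate? = map′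
    (λ (c-square , c-norm , c≢1 , φ-maps-C , stabilizer-parameters) → record
      { c-square = c-square ; c-norm = c-norm ; c≢1 = c≢1 ; φ-maps-C = φ-maps-C
      ; stabilizer-parameters = stabilizer-parameters })
    (λ cert → let open Certificate cert in c-square , c-norm , c≢1 , φ-maps-C , stabilizer-parameters)
    (isNonzeroSquare? c ×-dec c *F frob^ 2 c ≟ 1F ×-dec ¬? (c ≟ 1F) ×-dec MapsC? ⟦ φₐ ⟧ ×-dec
     All.all? (λ b → all? λ a → ¬? (a ≟ 0F) →-dec allUpTo? (λ k → MapsC? ⟦ semiAffine a b k ⟧ →-dec
       ((a ≟ 1F ×-dec b ≟ 0F ×-dec k ℕ.≟ 0) ⊎-dec (a ≟ c ×-dec b ≟ 0F ×-dec k ℕ.≟ 2))) 4) C-elements)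
    where
    MapsC? : ∀ f → Dec (MapsC f)
    MapsC? f = All.all? (λ x → f x ∈? C-elements) C-elements

  module _ (cert : Certificate) where
    open Certificate cert

    φ≗ : φ ≗ ⟦ φₐ ⟧
    φ≗ x = trans (cong (c *F_) (^9≗frob^2 x)) (sym (+-identityʳ _))

    φₐ-involutive : ⟦ φₐ ⟧ ∘ ⟦ φₐ ⟧ ≗ id
    φₐ-involutive x = begin
      ⟦ φₐ ⟧ (⟦ φₐ ⟧ x)                            ≡⟨ sym (⟦∘ₐ⟧ φₐ φₐ x) ⟩
      (c *F frob^ 2 c) *F frob^ 4 x +F (c *F frob^ 2 0F +F 0F)
        ≡⟨ cong₂ (λ u v → u *F v +F (c *F frob^ 2 0F +F 0F)) c-norm (frob^4 x) ⟩
      1F *F x +F (c *F frob^ 2 0F +F 0F)           ≡⟨ cong₂ _+F_ (*-identityˡ x) (⟦⟧-at-0 φₐ) ⟩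
      x +F 0F                                      ≡⟨ +-identityʳ x ⟩
      x                                            ∎
      where open ≡-Reasoning

    φ-involutive : φ ∘ φ ≗ id
    φ-involutive x = trans (φ≗ (φ x)) (trans (cong ⟦ φₐ ⟧ (φ≗ x)) (φₐ-involutive x))

    φ≢id : ¬ (φ ≗ id)
    φ≢id φ≗id = c≢1 (begin
      c             ≡⟨ sym (+-identityʳ c) ⟩
      c +F 0F       ≡⟨ sym (⟦⟧-at-1 φₐ) ⟩
      ⟦ φₐ ⟧ 1F     ≡⟨ sym (φ≗ 1F) ⟩
      φ 1F          ≡⟨ φ≗id 1F ⟩
      1F            ∎)
      where open ≡-Reasoning

    φₐ-image : image ⟦ φₐ ⟧ C ≐ C
    φₐ-image = image-involution C (MapsC⇒ φ-maps-C) φₐ-involutive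

    image-∘ₐφₐ : ∀ f → image ⟦ f ∘ₐ φₐ ⟧ C ≐ image ⟦ f ⟧ C
    image-∘ₐφₐ f = ≐-trans (image-≗ C (⟦∘ₐ⟧ f φₐ)) (≐-trans (image-∘ ⟦ f ⟧ ⟦ φₐ ⟧ C) (image-resp ⟦ f ⟧ φₐ-image))

    semiAffine-stabilizer : ∀ f → scale f ≢ 0F → (∀ x → C x → C (⟦ f ⟧ x)) → ⟦ f ⟧ ≗ id ⊎ ⟦ f ⟧ ≗ ⟦ φₐ ⟧
    semiAffine-stabilizer f@(semiAffine a b k) a≢0 f-maps =
      Sum.map identity twisted
        (All.lookup stabilizer-parameters b∈C a a≢0 (m%n<n k 4) (⇒MapsC (λ x Cx → subst C (f≗ x) (f-maps x Cx))))
      where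
      f≗ : ⟦ f ⟧ ≗ ⟦ semiAffine a b (k % 4) ⟧
      f≗ = ⟦⟧-≗ f (semiAffine a b (k % 4)) refl refl (frob^-mod4 k)
      b∈C : b ∈ C-elements
      b∈C = C⇒∈ (subst C (⟦⟧-at-0 f) (f-maps 0F (inj₁ refl)))
      identity : a ≡ 1F × b ≡ 0F × k % 4 ≡ 0 → ⟦ f ⟧ ≗ id
      identity (a≡1 , b≡0 , k%4≡0) x =
        trans (⟦⟧-≗ f (semiAffine 1F 0F 0) a≡1 b≡0 (frob^-mod4≡ k k%4≡0) x) (trans (+-identityʳ _) (*-identityˡ x))
      twisted : a ≡ c × b ≡ 0F × k % 4 ≡ 2 → ⟦ f ⟧ ≗ ⟦ φₐ ⟧
      twisted (a≡c , b≡0 , k%4≡2) = ⟦⟧-≗ f φₐ a≡c b≡0 (frob^-mod4≡ k k%4≡2)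

    stabilizer : ∀ g → Iff (image (applyAut g) C ≐ C) (applyAut g ≗ id ⊎ applyAut g ≗ φ)
    stabilizer g = stabilizes⇒ , ⇒stabilizes
      where
      open AutP g
      stabilizes⇒ : image (applyAut g) C ≐ C → applyAut g ≗ id ⊎ applyAut g ≗ φ
      stabilizes⇒ g[C]≐C =
        let (k , _ , g≗f) = applyAut-semiAffine g
            f-maps x Cx = subst C (g≗f x) (proj₁ (g[C]≐C (applyAut g x)) (x , Cx , refl))
        in Sum.map (λ f≗id x → trans (g≗f x) (f≗id x)) (λ f≗φₐ x → trans (g≗f x) (trans (f≗φₐ x) (sym (φ≗ x))))
                   (semiAffine-stabilizer (semiAffine a b k) (proj₁ aS) f-maps)
      ⇒stabilizes : applyAut g ≗ id ⊎ applyAut g ≗ φ → image (applyAut g) C ≐ C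
      ⇒stabilizes (inj₁ g≗id) = image-id C g≗id
      ⇒stabilizes (inj₂ g≗φ)  = ≐-trans (image-≗ C (λ x → trans (g≗φ x) (φ≗ x))) φₐ-image

    same-image⇒ : ∀ f f′ → scale f ≢ 0F → scale f′ ≢ 0F → image ⟦ f ⟧ C ≐ image ⟦ f′ ⟧ C →
                  ⟦ f ⟧ ≗ ⟦ f′ ⟧ ⊎ ⟦ f ⟧ ≗ ⟦ f′ ∘ₐ φₐ ⟧
    same-image⇒ f f′ f≢0 f′≢0 f[C]≐f′[C] =
      Sum.map (λ h≗id x → trans (f≗f′∘h x) (cong ⟦ f′ ⟧ (h≗id x)))
              (λ h≗φₐ x → trans (f≗f′∘h x) (trans (cong ⟦ f′ ⟧ (h≗φₐ x)) (sym (⟦∘ₐ⟧ f′ φₐ x))))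
              (semiAffine-stabilizer h (∘ₐ-nonzero (f′ ⁻¹ₐ) f (⁻¹ₐ-nonzero f′ f′≢0) f≢0) h-maps)
      where
      h : SemiAffine
      h = f′ ⁻¹ₐ ∘ₐ f
      f≗f′∘h : ⟦ f ⟧ ≗ ⟦ f′ ⟧ ∘ ⟦ h ⟧
      f≗f′∘h x = sym (trans (cong ⟦ f′ ⟧ (⟦∘ₐ⟧ (f′ ⁻¹ₐ) f x)) (⁻¹ₐ-inverseʳ f′ f′≢0 (⟦ f ⟧ x)))
      h-maps : ∀ x → C x → C (⟦ h ⟧ x)
      h-maps x Cx =
        let (y , Cy , f′y≡fx) = proj₁ (f[C]≐f′[C] (⟦ f ⟧ x)) (x , Cx , refl)
            y≡hx = trans (sym (⁻¹ₐ-inverseˡ f′ f′≢0 y)) (trans (cong ⟦ f′ ⁻¹ₐ ⟧ f′y≡fx) (sym (⟦∘ₐ⟧ (f′ ⁻¹ₐ) f x)))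
        in subst C y≡hx Cy

    φₐ-untwist : ∀ a b j → ⟦ semiAffine a b (2 ℕ.+ toℕ j) ∘ₐ φₐ ⟧ ≗ ⟦ semiAffine (a *F frob^ (2 ℕ.+ toℕ j) c) b (toℕ j) ⟧
    φₐ-untwist a b j =
      ⟦⟧-≗ (semiAffine a b (2 ℕ.+ toℕ j) ∘ₐ φₐ) (semiAffine (a *F frob^ (2 ℕ.+ toℕ j) c) b (toℕ j))
           refl (⟦⟧-at-0 (semiAffine a b (2 ℕ.+ toℕ j))) (frob^-mod4≡ (2 ℕ.+ toℕ j ℕ.+ 2) (twist+2-mod4 j))

    semiAffine-representative : ∀ a b {k} → IsNonzeroSquare a → k ℕ.< 4 →
                                ∃ λ t → image ⟦ semiAffine a b k ⟧ C ≐ image ⟦ representative t ⟧ C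
    semiAffine-representative a b a-square k<4 with split-twist k<4
    ... | j , inj₁ refl = Product.map₂ (image-≗ C) (representative-of b j a-square)
    ... | j , inj₂ refl = Product.map₂
      (λ f∘φₐ≗t → ≐-trans (≐-sym (image-∘ₐφₐ (semiAffine a b (2 ℕ.+ toℕ j))))
                           (image-≗ C (λ x → trans (φₐ-untwist a b j x) (f∘φₐ≗t x))))
      (representative-of b j (*-square a-square (frob^-square (2 ℕ.+ toℕ j) c-square)))

    orbit-cover : ∀ g → ∃ λ t → image (applyAut g) C ≐ image ⟦ representative t ⟧ C
    orbit-cover g with applyAut-semiAffine g
    ... | k , k<4 , g≗f =
      Product.map₂ (≐-trans (image-≗ C g≗f)) (semiAffine-representative (AutP.a g) (AutP.b g) (AutP.aS g) k<4)

    orbit-injective : ∀ t t′ → image ⟦ representative t ⟧ C ≐ image ⟦ representative t′ ⟧ C → t ≡ t′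
    orbit-injective t@(i , b , j) t′@(i′ , b′ , j′) t[C]≐t′[C] =
      [ same-parameters , ⊥-elim ∘ twisted-parameters ]′
        (same-image⇒ f f′ (root²-nonzero i) (root²-nonzero i′) t[C]≐t′[C])
      where
      f f′ : SemiAffine
      f = representative t
      f′ = representative t′
      same-parameters : ⟦ f ⟧ ≗ ⟦ f′ ⟧ → t ≡ t′
      same-parameters f≗f′ =
        cong₂ _,_ (root²-injective i i′ (proj₁ parameters))
                  (cong₂ _,_ (proj₁ (proj₂ parameters)) (twists-distinct j j′ (proj₂ (proj₂ parameters) 𝕪)))
        where
        parameters : root i *F root i ≡ root i′ *F root i′ × b ≡ b′ × frob^ (toℕ j) ≗ frob^ (toℕ j′)
        parameters = ⟦⟧-injective-parameters f f′ (root²-nonzero i) f≗f′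
      twisted-parameters : ¬ (⟦ f ⟧ ≗ ⟦ f′ ∘ₐ φₐ ⟧)
      twisted-parameters f≗f′∘φₐ =
        twists-apart j j′ (proj₂ (proj₂ (⟦⟧-injective-parameters f (f′ ∘ₐ φₐ) (root²-nonzero i) f≗f′∘φₐ)) 𝕪)

    orbit-size : OrbitHasSize C 6480
    orbit-size = orbitHasSize-by-representatives C Fin6480↔Representative representativeAut orbit-cover orbit-injective

admissible-pairs : List (F9 × F81)
admissible-pairs =
  (mk9 t3 t3 , mk81 0₉ (mk9 z3 o3)) ∷ (mk9 t3 t3 , mk81 0₉ (mk9 z3 t3)) ∷
  (mk9 t3 o3 , mk81 0₉ (mk9 o3 t3)) ∷ (mk9 t3 o3 , mk81 0₉ (mk9 t3 o3)) ∷ []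

opaque
  unfolding frob

  certificates : All (uncurry Configuration.Certificate) admissible-pairs
  certificates = from-yes (All.all? (uncurry Configuration.certificate?) admissible-pairs)

^₉4-* : ∀ x y → (x *₉ y) ^₉ 4 ≡ (x ^₉ 4) *₉ (y ^₉ 4)
^₉4-* = from-yes (all₉? λ x → all₉? λ y → (x *₉ y) ^₉ 4 ≟₉ (x ^₉ 4) *₉ (y ^₉ 4))

primitive⇒^4≢1 : ∀ {δ} → IsPrimitive9 δ → δ ^₉ 4 ≢ 1₉
primitive⇒^4≢1 {δ} δ-primitive δ⁴≡1 =
  let (k , δᵏ≡ν) = δ-primitive ν (λ ()) in ν⁴≢1 (subst (λ x → x ^₉ 4 ≡ 1₉) δᵏ≡ν (powers k))
  where
  ν⁴≢1 : ν ^₉ 4 ≢ 1₉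
  ν⁴≢1 ()
  powers : ∀ n → (δ ^₉ n) ^₉ 4 ≡ 1₉
  powers zero    = refl
  powers (suc n) = trans (^₉4-* δ (δ ^₉ n)) (cong₂ _*₉_ δ⁴≡1 (powers n))

-- Of the eight α with α² primitive in 𝔽₉, the square condition at x = 1 rules out four.
admissible : ∀ {δ α} → IsPrimitive9 δ → α *F α ≡ ι δ →
             (IsNonzeroSquare (ι 1₉ +F α) → (1₉ ≡ δ) ⊎ (1₉ ≡ δ ^₉ 2) ⊎ (1₉ ≡ δ ^₉ 5) ⊎ (1₉ ≡ δ ^₉ 6)) →
             (δ , α) ∈ admissible-pairs
admissible {δ} {α} δ-primitive = decided δ α (primitive⇒^4≢1 δ-primitive)
  where
  decided : ∀ δ α → δ ^₉ 4 ≢ 1₉ → α *F α ≡ ι δ →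
            (IsNonzeroSquare (ι 1₉ +F α) → (1₉ ≡ δ) ⊎ (1₉ ≡ δ ^₉ 2) ⊎ (1₉ ≡ δ ^₉ 5) ⊎ (1₉ ≡ δ ^₉ 6)) →
            (δ , α) ∈ admissible-pairs
  decided = from-yes (all₉? λ δ → all? λ α → ¬? (δ ^₉ 4 ≟₉ 1₉) →-dec α *F α ≟ ι δ →-dec
              (isNonzeroSquare? (ι 1₉ +F α) →-dec (1₉ ≟₉ δ ⊎-dec 1₉ ≟₉ δ ^₉ 2 ⊎-dec 1₉ ≟₉ δ ^₉ 5 ⊎-dec 1₉ ≟₉ δ ^₉ 6)) →-dec
              (δ , α) ∈ₚ? admissible-pairs)

lemma3p1 : (δ : F9) (α : F81) →
  IsPrimitive9 δ →
  α *F α ≡ ι δ →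
  (∀ (x : F9) → Iff (IsNonzeroSquare (ι x +F α))
                    ((x ≡ δ) ⊎ (x ≡ δ ^₉ 2) ⊎ (x ≡ δ ^₉ 5) ⊎ (x ≡ δ ^₉ 6))) →
  -- φ' belongs to Aut(P(81)) and has order 2
  (IsNonzeroSquare (α +F ι (δ ^₉ 5)) × IsFieldAut (λ γ → γ ^F 9) ×
   ¬ (∀ γ → φ′ δ α γ ≡ γ) × (∀ γ → φ′ δ α (φ′ δ α γ) ≡ γ) ×
  -- the setwise stabilizer of C₉ is {id, φ'}
   (∀ (g : AutP) → Iff (image (applyAut g) (C9 δ α) ≐ C9 δ α)
                      ((∀ γ → applyAut g γ ≡ γ) ⊎ (∀ γ → applyAut g γ ≡ φ′ δ α γ)))) ×
  -- the orbit of C₉ has size 6480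
  OrbitHasSize (C9 δ α) 6480
lemma3p1 δ α δ-primitive α²≡δ square-condition =
  (c-square , IsFieldAut-≗ ^9≗frob^2 (frob^-isFieldAut 2) , φ≢id cert , φ-involutive cert , stabilizer cert) ,
  orbit-size cert
  where
  open Configuration δ α
  cert : Certificate
  cert = All.lookup certificates (admissible δ-primitive α²≡δ (proj₁ (square-condition 1₉)))
  open Certificate cert using (c-square)
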